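{- Let $n\geq 1$, and colour the edges of the complete graph on vertices $u_1,\dots,u_{2n}$ with colours $\{1,\dots,n\}$ by giving the edge $\{u_i,u_j\}$ ($i\neq j$) the colour $s_n\big(\lceil\tfrac{(j-i)+1}{2}\rceil+i-1\big)$. Then for all $i,j,k\in\{1,\dots,n\}$ not all equal, there are three distinct vertices $x,y,z$ such that the edges $\{x,y\},\{x,z\},\{y,z\}$ have colours $i,j,k$ respectively.
   Context: For a positive integer $m$, $s_m\colon\mathbb Z\to\{1,\dots,m\}$ is the map $x\mapsto R_m(x-1)+1$, where $R_m(k)\in\{0,\dots,m-1\}$ is the residue of $k$ modulo $m$. The colouring is well defined (it does not depend on the order of $i,j$); it is the colouring obtained from Walecki's construction: for each colour, a zigzag Hamiltonian path on the $2n$ vertices placed on a circle, rotated one step per colour. -}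

module Defs where

open import Data.Nat as ℕ using (ℕ; NonZero)
open import Data.Integer using (ℤ; +_; _+_; _-_; _/ℕ_; _%ℕ_)

-- ⌈ m / 2 ⌉ for an integer m  (_/ℕ_ is floor division, so ⌈m/2⌉ = ⌊(m+1)/2⌋)
⌈_/2⌉ : ℤ → ℤ
⌈ m /2⌉ = (m + + 1) /ℕ 2

s : (m : ℕ) → {{NonZero m}} → ℤ → ℕ
s m x = ℕ.suc ((x - + 1) %ℕ m)

colour : (n : ℕ) → {{NonZero n}} → ℕ → ℕ → ℕ
colour n i j = s n (⌈ (+ j - + i) + + 1 /2⌉ + + i - + 1)

{-# OPTIONS --safe #-}
module Submission where

-- Writing the endpoints as p = a + 1 and q = b + 1, the colour of {p, q} is
-- 1 + (⌊(a + b)/2⌋ mod n): it is symmetric and depends only on a + b mod 2n.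
-- Labelling vertices by residues mod 2n, it therefore suffices to find labels
-- a, b, c with a + b ≡ 2i + 1, a + c ≡ 2j + 1 and b + c ≡ 2k (mod 2n) for
-- 0-based colours i ≠ j. The parities of these sums keep x apart from y and z,
-- and i ≠ j keeps y apart from z. When i = j we have i ≠ k, and swapping x and
-- y turns a triangle coloured (i, k, j) into one coloured (i, j, k).

open import Defs
open import Data.Nat using (ℕ; NonZero; _≤_; _*_)
open import Data.Product using (_×_; ∃-syntax)
open import Relation.Nullary using (¬_)
open import Relation.Binary.PropositionalEquality using (_≡_; _≢_)

import Data.Nat as ℕ
open import Data.Nat using (zero; suc; _∸_; _<_; _/_; _%_; _≟_; z<s; s<s)
open import Data.Nat.Properties using (suc-injective; 1+n≢0; +-comm; *-comm; m+[n∸m]≡n; m*n≢0)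
open import Data.Nat.DivMod
open import Data.Nat.Divisibility using (divides-refl)
open import Data.Product using (_,_; proj₁)
open import Relation.Nullary using (yes; no)
open import Relation.Binary.PropositionalEquality using (refl; sym; trans; cong; cong₂; subst)
open import Relation.Binary.PropositionalEquality.Properties using (module ≡-Reasoning)
open ≡-Reasoning

module _ where
  open import Data.Integer using (+_; -[1+_]; -_; _+_; _-_; _/ℕ_; _%ℕ_)
  open import Data.Integer.Properties using (+-identityʳ)
  open import Data.Integer.Tactic.RingSolver using (solve-∀)

  -[1+n]/ℕ2≡-[1+n/2] : ∀ n → -[1+ n ] /ℕ 2 ≡ -[1+ n / 2 ]
  -[1+n]/ℕ2≡-[1+n/2] n with suc n % 2 in eq | m≡m%n+[m/n]*n (suc n) 2
  ... | zero | _ = cong (λ q → - + q) (begin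
    suc n / 2                     ≡⟨ cong (λ m → suc m / 2) (m≡m%n+[m/n]*n n 2) ⟩
    suc (n % 2 ℕ.+ n / 2 * 2) / 2 ≡⟨ cong (λ r → suc (r ℕ.+ n / 2 * 2) / 2) (%-pred-≡0 {n} {2} eq) ⟩
    suc (n / 2) * 2 / 2           ≡⟨ m*n/n≡m (suc (n / 2)) 2 ⟩
    suc (n / 2)                   ∎)
  ... | suc zero | suc-n≡1+[suc-n/2]*2 = cong -[1+_] (begin
    suc n / 2         ≡⟨ m*n/n≡m (suc n / 2) 2 ⟨
    suc n / 2 * 2 / 2 ≡⟨ cong (λ m → ℕ.pred m / 2) suc-n≡1+[suc-n/2]*2 ⟨
    n / 2             ∎)
  ... | suc (suc _) | _ with s<s (s<s ()) ← subst (_< 2) eq (m%n<n (suc n) 2)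

  [i+2]/ℕ2≡i/ℕ2+1 : ∀ i → (i + + 2) /ℕ 2 ≡ i /ℕ 2 + + 1
  [i+2]/ℕ2≡i/ℕ2+1 (+ n) = cong +_ (+-distrib-/-∣ʳ n {2} {2} (divides-refl 1))
  [i+2]/ℕ2≡i/ℕ2+1 -[1+ 0 ] = refl
  [i+2]/ℕ2≡i/ℕ2+1 -[1+ 1 ] = refl
  [i+2]/ℕ2≡i/ℕ2+1 -[1+ suc (suc n) ] = begin
    -[1+ n ] /ℕ 2                 ≡⟨ -[1+n]/ℕ2≡-[1+n/2] n ⟩
    -[1+ n / 2 ]                  ≡⟨⟩
    -[1+ suc (n / 2) ] + + 1      ≡⟨ cong (λ q → -[1+ q ] + + 1) (+-distrib-/-∣ˡ {2} n {2} (divides-refl 1)) ⟨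
    -[1+ suc (suc n) / 2 ] + + 1  ≡⟨ cong (_+ + 1) (-[1+n]/ℕ2≡-[1+n/2] (suc (suc n))) ⟨
    -[1+ suc (suc n) ] /ℕ 2 + + 1 ∎

  [i+k+k]/ℕ2≡i/ℕ2+k : ∀ i k → (i + + k + + k) /ℕ 2 ≡ i /ℕ 2 + + k
  [i+k+k]/ℕ2≡i/ℕ2+k i zero = begin
    (i + + 0 + + 0) /ℕ 2 ≡⟨ cong (_/ℕ 2) (trans (+-identityʳ (i + + 0)) (+-identityʳ i)) ⟩
    i /ℕ 2               ≡⟨ +-identityʳ (i /ℕ 2) ⟨
    i /ℕ 2 + + 0         ∎
  [i+k+k]/ℕ2≡i/ℕ2+k i (suc k) = begin
    (i + + suc k + + suc k) /ℕ 2 ≡⟨ cong (_/ℕ 2) (regroup i (+ k)) ⟩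
    (i + + k + + k + + 2) /ℕ 2   ≡⟨ [i+2]/ℕ2≡i/ℕ2+1 (i + + k + + k) ⟩
    (i + + k + + k) /ℕ 2 + + 1   ≡⟨ cong (_+ + 1) ([i+k+k]/ℕ2≡i/ℕ2+k i k) ⟩
    i /ℕ 2 + + k + + 1           ≡⟨ +-suc (i /ℕ 2) (+ k) ⟩
    i /ℕ 2 + + suc k             ∎
    where
    regroup : ∀ i k → i + (+ 1 + k) + (+ 1 + k) ≡ i + k + k + + 2
    regroup = solve-∀
    +-suc : ∀ i k → i + k + + 1 ≡ i + (+ 1 + k)
    +-suc = solve-∀

  colour-suc : ∀ n {{_ : NonZero n}} a b → colour n (suc a) (suc b) ≡ suc ((a ℕ.+ b) / 2 % n)
  colour-suc n a b = cong (λ t → suc (t %ℕ n)) (begin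
    ⌈ dividend /2⌉ + + suc a - + 1 - + 1 ≡⟨ regroup ⌈ dividend /2⌉ (+ a) ⟩
    ⌈ dividend /2⌉ + + a - + 1           ≡⟨ cong (_- + 1) ⌈dividend/2⌉+a ⟩
    + ((a ℕ.+ b) / 2) + + 1 - + 1        ≡⟨ cancel (+ ((a ℕ.+ b) / 2)) ⟩
    + ((a ℕ.+ b) / 2)                    ∎)
    where
    dividend = (+ suc b - + suc a) + + 1
    regroup : ∀ h a → h + (+ 1 + a) - + 1 - + 1 ≡ h + a - + 1
    regroup = solve-∀
    cancel : ∀ h → h + + 1 - + 1 ≡ h
    cancel = solve-∀
    expand : ∀ a b → (((+ 1 + b) - (+ 1 + a)) + + 1) + + 1 + a + a ≡ a + b + + 2
    expand = solve-∀
    ⌈dividend/2⌉+a : ⌈ dividend /2⌉ + + a ≡ + ((a ℕ.+ b) / 2) + + 1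
    ⌈dividend/2⌉+a = begin
      ⌈ dividend /2⌉ + + a                ≡⟨ [i+k+k]/ℕ2≡i/ℕ2+k (dividend + + 1) a ⟨
      (dividend + + 1 + + a + + a) /ℕ 2   ≡⟨ cong (_/ℕ 2) (expand (+ a) (+ b)) ⟩
      (+ a + + b + + 2) /ℕ 2              ≡⟨ [i+2]/ℕ2≡i/ℕ2+1 (+ (a ℕ.+ b)) ⟩
      + ((a ℕ.+ b) / 2) + + 1             ∎

open import Data.Nat using (_+_)
open import Data.Nat.Tactic.RingSolver using (solve-∀)

[α+m*2]/2≡m : ∀ {α} m → α < 2 → (α + m * 2) / 2 ≡ m
[α+m*2]/2≡m {α} m α<2 = begin
  (α + m * 2) / 2   ≡⟨ +-distrib-/-∣ʳ α (divides-refl m) ⟩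
  α / 2 + m * 2 / 2 ≡⟨ cong₂ _+_ (m<n⇒m/n≡0 α<2) (m*n/n≡m m 2) ⟩
  m                 ∎

colour-comm : ∀ n {{_ : NonZero n}} {x y} → 1 ≤ x → 1 ≤ y → colour n x y ≡ colour n y x
colour-comm n {suc a} {suc b} _ _ = begin
  colour n (suc a) (suc b) ≡⟨ colour-suc n a b ⟩
  suc ((a + b) / 2 % n)    ≡⟨ cong (λ t → suc (t / 2 % n)) (+-comm a b) ⟩
  suc ((b + a) / 2 % n)    ≡⟨ colour-suc n b a ⟨
  colour n (suc b) (suc a) ∎

Triangle : (n : ℕ) → {{NonZero n}} → ℕ → ℕ → ℕ → Set
Triangle n i j k = ∃[ x ] ∃[ y ] ∃[ z ]
  ((1 ≤ x × x ≤ 2 * n) × (1 ≤ y × y ≤ 2 * n) × (1 ≤ z × z ≤ 2 * n) ×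
   x ≢ y × x ≢ z × y ≢ z ×
   colour n x y ≡ i × colour n x z ≡ j × colour n y z ≡ k)

triangle-swap : ∀ n {{_ : NonZero n}} {i j k} → Triangle n i k j → Triangle n i j k
triangle-swap n (x , y , z , x∈ , y∈ , z∈ , x≢y , x≢z , y≢z , xy , xz , yz) =
  y , x , z , y∈ , x∈ , z∈ , (λ y≡x → x≢y (sym y≡x)) , y≢z , x≢z ,
  trans (colour-comm n (proj₁ y∈) (proj₁ x∈)) xy , yz , xz

module _ (n : ℕ) {{_ : NonZero n}} where

  instance
    2n≢0 : NonZero (n * 2)
    2n≢0 = m*n≢0 n 2

  vertex : ℕ → ℕ
  vertex a = suc (a % (n * 2))

  vertex-∈ : ∀ a → 1 ≤ vertex a × vertex a ≤ 2 * n
  vertex-∈ a = z<s , subst (vertex a ≤_) (*-comm n 2) (m%n<n a (n * 2))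

  colour-vertex : ∀ a b → colour n (vertex a) (vertex b) ≡ suc ((a + b) / 2 % n)
  colour-vertex a b = begin
    colour n (vertex a) (vertex b)                  ≡⟨ colour-suc n (a % (n * 2)) (b % (n * 2)) ⟩
    suc ((a % (n * 2) + b % (n * 2)) / 2 % n)       ≡⟨ cong suc (m%[n*o]/o≡m/o%n (a % (n * 2) + b % (n * 2)) n 2) ⟨
    suc ((a % (n * 2) + b % (n * 2)) % (n * 2) / 2) ≡⟨ cong (λ r → suc (r / 2)) (%-distribˡ-+ a b (n * 2)) ⟨
    suc ((a + b) % (n * 2) / 2)                     ≡⟨ cong suc (m%[n*o]/o≡m/o%n (a + b) n 2) ⟩
    suc ((a + b) / 2 % n)                           ∎

  colour-vertex-sum : ∀ {a b α c} → α < 2 → c < n → a + b ≡ α + (c + n) * 2 →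
                      colour n (vertex a) (vertex b) ≡ suc c
  colour-vertex-sum {a} {b} {α} {c} α<2 c<n a+b = begin
    colour n (vertex a) (vertex b)  ≡⟨ colour-vertex a b ⟩
    suc ((a + b) / 2 % n)           ≡⟨ cong (λ s → suc (s / 2 % n)) a+b ⟩
    suc ((α + (c + n) * 2) / 2 % n) ≡⟨ cong (λ h → suc (h % n)) ([α+m*2]/2≡m (c + n) α<2) ⟩
    suc ((c + n) % n)               ≡⟨ cong suc ([m+n]%n≡m%n c n) ⟩
    suc (c % n)                     ≡⟨ cong suc (m<n⇒m%n≡m c<n) ⟩
    suc c                           ∎

  vertex-≡⇒[+]%2≡ : ∀ {a b} c → vertex a ≡ vertex b → (a + c) % 2 ≡ (b + c) % 2
  vertex-≡⇒[+]%2≡ {a} {b} c va≡vb = begin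
    (a + c) % 2                               ≡⟨ m∣n⇒o%n%m≡o%m 2 (n * 2) (a + c) (divides-refl n) ⟨
    (a + c) % (n * 2) % 2                     ≡⟨ cong (_% 2) (%-distribˡ-+ a c (n * 2)) ⟩
    (a % (n * 2) + c % (n * 2)) % (n * 2) % 2 ≡⟨ cong (λ r → (r + c % (n * 2)) % (n * 2) % 2) (suc-injective va≡vb) ⟩
    (b % (n * 2) + c % (n * 2)) % (n * 2) % 2 ≡⟨ cong (_% 2) (%-distribˡ-+ b c (n * 2)) ⟨
    (b + c) % (n * 2) % 2                     ≡⟨ m∣n⇒o%n%m≡o%m 2 (n * 2) (b + c) (divides-refl n) ⟩
    (b + c) % 2                               ∎

  vertex-≢-by-parity : ∀ a b c {m m′} → a + c ≡ 1 + m * 2 → b + c ≡ m′ * 2 → vertex a ≢ vertex b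
  vertex-≢-by-parity a b c {m} {m′} a+c b+c va≡vb = 1+n≢0 (begin
    1               ≡⟨ [m+kn]%n≡m%n 1 m 2 ⟨
    (1 + m * 2) % 2 ≡⟨ cong (_% 2) a+c ⟨
    (a + c) % 2     ≡⟨ vertex-≡⇒[+]%2≡ c va≡vb ⟩
    (b + c) % 2     ≡⟨ cong (_% 2) b+c ⟩
    m′ * 2 % 2      ≡⟨ m*n%n≡0 m′ 2 ⟩
    0               ∎)

  +-twice-n : ∀ α m {u v} → u ≡ n → v ≡ n → α + m * 2 + u + v ≡ α + (m + n) * 2
  +-twice-n α m u≡n v≡n = trans (cong₂ (λ u v → α + m * 2 + u + v) u≡n v≡n) (regroup α m n)
    where
    regroup : ∀ α m n → α + m * 2 + n + n ≡ α + (m + n) * 2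
    regroup = solve-∀

  -- The labels solve a + b = 2i + 1 + 2n, a + c = 2j + 1 + 2n, b + c = 2k + 2n;
  -- the offset 2n keeps them natural numbers.
  triangle-of-≢ : ∀ {i j k} → i < n → j < n → k < n → i ≢ j → Triangle n (suc i) (suc j) (suc k)
  triangle-of-≢ {i} {j} {k} i<n j<n k<n i≢j =
    vertex a , vertex b , vertex c , vertex-∈ a , vertex-∈ b , vertex-∈ c ,
    vertex-≢-by-parity a b c {j + n} {k + n} a+c b+c ,
    vertex-≢-by-parity a c b {i + n} {k + n} a+b (trans (+-comm c b) b+c) ,
    b≢c , colour-ab , colour-ac , colour-vertex-sum z<s k<n b+c
    where
    di = n ∸ suc i
    dj = n ∸ suc j
    dk = n ∸ suc k
    a = suc i + suc j + dk
    b = i + suc k + dj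
    c = j + suc k + di
    expand-a+b : ∀ i j k di dj dk →
      (suc i + suc j + dk) + (i + suc k + dj) ≡ 1 + i * 2 + (suc j + dj) + (suc k + dk)
    expand-a+b = solve-∀
    expand-a+c : ∀ i j k di dj dk →
      (suc i + suc j + dk) + (j + suc k + di) ≡ 1 + j * 2 + (suc i + di) + (suc k + dk)
    expand-a+c = solve-∀
    expand-b+c : ∀ i j k di dj dk →
      (i + suc k + dj) + (j + suc k + di) ≡ 0 + k * 2 + (suc i + di) + (suc j + dj)
    expand-b+c = solve-∀
    a+b : a + b ≡ 1 + (i + n) * 2
    a+b = trans (expand-a+b i j k di dj dk) (+-twice-n 1 i (m+[n∸m]≡n j<n) (m+[n∸m]≡n k<n))
    a+c : a + c ≡ 1 + (j + n) * 2
    a+c = trans (expand-a+c i j k di dj dk) (+-twice-n 1 j (m+[n∸m]≡n i<n) (m+[n∸m]≡n k<n))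
    b+c : b + c ≡ (k + n) * 2
    b+c = trans (expand-b+c i j k di dj dk) (+-twice-n 0 k (m+[n∸m]≡n i<n) (m+[n∸m]≡n j<n))
    colour-ab : colour n (vertex a) (vertex b) ≡ suc i
    colour-ab = colour-vertex-sum (s<s z<s) i<n a+b
    colour-ac : colour n (vertex a) (vertex c) ≡ suc j
    colour-ac = colour-vertex-sum (s<s z<s) j<n a+c
    b≢c : vertex b ≢ vertex c
    b≢c vb≡vc = i≢j (suc-injective (begin
      suc i                          ≡⟨ colour-ab ⟨
      colour n (vertex a) (vertex b) ≡⟨ cong (colour n (vertex a)) vb≡vc ⟩
      colour n (vertex a) (vertex c) ≡⟨ colour-ac ⟩
      suc j                          ∎))

lemma26 : (n : ℕ) → {{_ : NonZero n}} →
    (i j k : ℕ) → 1 ≤ i → i ≤ n → 1 ≤ j → j ≤ n → 1 ≤ k → k ≤ n →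
    ¬ (i ≡ j × j ≡ k) →
    ∃[ x ] ∃[ y ] ∃[ z ]
      ((1 ≤ x × x ≤ 2 * n) × (1 ≤ y × y ≤ 2 * n) × (1 ≤ z × z ≤ 2 * n) ×
       x ≢ y × x ≢ z × y ≢ z ×
       colour n x y ≡ i × colour n x z ≡ j × colour n y z ≡ k)
lemma26 n (suc i) (suc j) (suc k) _ i<n _ j<n _ k<n not-all-equal with i ≟ j
... | no i≢j = triangle-of-≢ n i<n j<n k<n i≢j
... | yes refl = triangle-swap n (triangle-of-≢ n i<n k<n j<n i≢k)
  where
  i≢k : i ≢ k
  i≢k i≡k = not-all-equal (refl , cong suc i≡k)
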